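{- Let $\simeq$ be the smallest equivalence relation on the class $\Gamma$ of all rooted graphs such that any two rooted-isomorphic rooted graphs are $\simeq$-equivalent and such that $(G,S)\simeq(G/\sim,[S]_\sim)$ for every $(G,S)\in\Gamma$ and every non-edge-collapsing equivalence relation $\sim$ on $G$. Then for all $(G,S),(H,R)\in\Gamma$, the unfolding trees $\mathcal{T}(G,S)$ and $\mathcal{T}(H,R)$ are rooted-isomorphic if and only if $(G,S)\simeq(H,R)$.
   Context: A graph is $G=(V,E,o,t)$ with vertex set $V$, edge set $E$ and maps $o,t:E\to V$ (origin, terminus); loops and multiple edges allowed. An isomorphism is a pair of bijections on vertices and edges compatible with $o,t$. A walk is an empty walk $\epsilon_v$ ($O=T=v$) or a sequence $e_1\dots e_n$ with $t(e_i)=o(e_{i+1})$, $O=o(e_1)$, $T=t(e_n)$. A root of $G$ is a vertex from which every vertex is reachable by a walk; a rooted graph is $(G,S)$ with $S$ a root. Rooted graphs $(G,S),(H,R)$ are rooted-isomorphic if an isomorphism $G\to H$ maps $S$ to $R$. The unfolding tree $\mathcal{T}(G,S)$ has vertices the walks with origin $S$, an edge from $w$ to $we$ whenever $e$ is an edge and $we$ a walk, and root $\epsilon_S$. An equivalence relation $\sim$ on $G$ is a pair of equivalence relations $\sim_V$ on $V$ and $\sim_E$ on $E$ with $e_1\sim_E e_2\Rightarrow o(e_1)\sim_V o(e_2)$ and $t(e_1)\sim_V t(e_2)$; the quotient $G/\sim$ has vertices $V/\sim_V$, edges $E/\sim_E$, $o([e])=[o(e)]$, $t([e])=[t(e)]$.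 It is non-edge-collapsing if for all $v\sim_V v'$ and every edge $e$ with $o(e)=v$ there is exactly one edge $e'$ with $o(e')=v'$ and $e\sim_E e'$. -}

module Defs where

open import Data.Product using (Σ; Σ-syntax; _×_; _,_)
open import Relation.Binary.PropositionalEquality using (_≡_)
open import Relation.Binary.Core using (Rel)
open import Level using (0ℓ)
open import Relation.Binary.Structures using (IsEquivalence)
open import Function.Definitions using (Bijective; Surjective)
open import Function.Bundles using (_⇔_)

record Graph : Set₁ where
  field
    V : Set
    E : Set
    o : E → V
    t : E → V
open Graph public

data WalkFrom (G : Graph) (S : V G) : V G → Set where
  ε    : WalkFrom G S S
  _∷ʳ_ : ∀ {e-origin} → WalkFrom G S e-origin → (e : E G) → {_ : o G e ≡ e-origin} → WalkFrom G S (t G e)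

record Iso (G H : Graph) : Set where
  field
    fV    : V G → V H
    fE    : E G → E H
    fV-bij : Bijective _≡_ _≡_ fV
    fE-bij : Bijective _≡_ _≡_ fE
    o-comm : ∀ e → o H (fE e) ≡ fV (o G e)
    t-comm : ∀ e → t H (fE e) ≡ fV (t G e)

IsRoot : (G : Graph) → V G → Set
IsRoot G S = ∀ v → WalkFrom G S v

record Rooted : Set₁ where
  constructor rooted
  field
    graph : Graph
    root  : V graph
    isRoot : IsRoot graph root
open Rooted public

record RootedIso (A B : Rooted) : Set where
  field
    iso : Iso (graph A) (graph B)
    root-pres : Iso.fV iso (root A) ≡ root B

record GraphEquiv (G : Graph) : Set₁ where
  field
    _~V_ : Rel (V G) 0ℓ
    _~E_ : Rel (E G) 0ℓ
    ~V-equiv : IsEquivalence _~V_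
    ~E-equiv : IsEquivalence _~E_
    o-resp : ∀ {e₁ e₂} → e₁ ~E e₂ → o G e₁ ~V o G e₂
    t-resp : ∀ {e₁ e₂} → e₁ ~E e₂ → t G e₁ ~V t G e₂

NonEdgeCollapsing : {G : Graph} → GraphEquiv G → Set
NonEdgeCollapsing {G} R =
  ∀ v v' → v ~V v' → ∀ e → o G e ≡ v →
    Σ[ e' ∈ E G ] ((o G e' ≡ v' × e ~E e') ×
      (∀ e'' → o G e'' ≡ v' → e ~E e'' → e'' ≡ e'))
  where open GraphEquiv R

-- H (with projections pV, pE) is the quotient graph G/∼: pV, pE are surjective,
-- identify exactly the ∼-related elements, and o, t of H are induced from G.
-- (Quotient types are unavailable; this determines G/∼ up to isomorphism.)
record IsQuotient (G : Graph) (R : GraphEquiv G) (H : Graph)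
                  (pV : V G → V H) (pE : E G → E H) : Set where
  open GraphEquiv R
  field
    pV-surj : Surjective _≡_ _≡_ pV
    pE-surj : Surjective _≡_ _≡_ pE
    pV-ker  : ∀ x y → (pV x ≡ pV y) ⇔ (x ~V y)
    pE-ker  : ∀ x y → (pE x ≡ pE y) ⇔ (x ~E y)
    o-ind   : ∀ e → o H (pE e) ≡ pV (o G e)
    t-ind   : ∀ e → t H (pE e) ≡ pV (t G e)

data _≃_ : Rooted → Rooted → Set₁ where
  ≃-iso   : ∀ {A B} → RootedIso A B → A ≃ B
  ≃-quot  : ∀ (A : Rooted) (R : GraphEquiv (graph A)) → NonEdgeCollapsing R →
            ∀ (H : Graph) (pV : V (graph A) → V H) (pE : E (graph A) → E H) →
            IsQuotient (graph A) R H pV pE →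
            (r : IsRoot H (pV (root A))) →
            A ≃ rooted H (pV (root A)) r
  ≃-refl  : ∀ {A} → A ≃ A
  ≃-sym   : ∀ {A B} → A ≃ B → B ≃ A
  ≃-trans : ∀ {A B C} → A ≃ B → B ≃ C → A ≃ C

UnfoldGraph : (G : Graph) → V G → Graph
UnfoldGraph G S = record
  { V = Σ[ v ∈ V G ] WalkFrom G S v
  ; E = Σ[ e ∈ E G ] WalkFrom G S (o G e)
  ; o = λ { (e , w) → (o G e , w) }
  ; t = λ { (e , w) → (t G e , _∷ʳ_ w e {_≡_.refl}) }
  }

unfold-reach′ : (G : Graph) (S : V G) (v : V G) (w : WalkFrom G S v) →
                WalkFrom (UnfoldGraph G S) (S , ε) (v , w)
unfold-reach′ G S v ε = ε
unfold-reach′ G S .(t G e) (_∷ʳ_ {u} w e {_≡_.refl}) =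
  _∷ʳ_ (unfold-reach′ G S u w) (e , w) {_≡_.refl}

unfold-reach : (G : Graph) (S : V G) → IsRoot (UnfoldGraph G S) (S , ε)
unfold-reach G S (v , w) = unfold-reach′ G S v w

𝒯 : Rooted → Rooted
𝒯 A = rooted (UnfoldGraph (graph A) (root A)) (root A , ε)
             (unfold-reach (graph A) (root A))

{-# OPTIONS --safe #-}
-- A covering, i.e. a graph map G → H that is bijective on out-edges at every
-- vertex, lifts each walk of H from f(S) uniquely to a walk of G from S, so it
-- induces an isomorphism of unfolding trees. Isomorphisms and quotient maps of non-edge-collapsing
-- relations are coverings, hence the unfolding tree is an invariant of ≃.
-- Conversely, sending a walk to its terminus is a covering 𝒯(G,S) → G whose
-- kernel is non-edge-collapsing with quotient G, so (G,S) ≃ 𝒯(G,S).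
module Submission where

open import Defs
open import Function.Base using (id; _∘_)
open import Function.Bundles using (_⇔_; mk⇔; mk⤖; mk↔ₛ′; module Equivalence; module Inverse; module Bijection)
open import Function.Definitions using (Bijective; Surjective)
open import Function.Properties.Bijection using (⤖⇒↔)
open import Function.Properties.Inverse using (↔⇒⤖)
import Function.Construct.Composition as Composition
import Function.Construct.Identity as Identity
open import Data.Product using (Σ-syntax; _×_; _,_; proj₁; proj₂)
open import Relation.Binary.PropositionalEquality
import Relation.Binary.Construct.On as On
open import Relation.Binary.Structures using (IsEquivalence)

inverses⇒bijective : ∀ {A B : Set} (f : A → B) (g : B → A) →
                     (∀ y → f (g y) ≡ y) → (∀ x → g (f x) ≡ x) → Bijective _≡_ _≡_ f
inverses⇒bijective f g f∘g g∘f = Bijection.bijective (↔⇒⤖ (mk↔ₛ′ f g f∘g g∘f))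

module _ {G H : Graph} (i : Iso G H) where
  open Iso i
  private
    module IV = Inverse (⤖⇒↔ (mk⤖ fV-bij))
    module IE = Inverse (⤖⇒↔ (mk⤖ fE-bij))

    inverse-comm : (sG : E G → V G) (sH : E H → V H) →
                   (∀ e → sH (fE e) ≡ fV (sG e)) → ∀ h → sG (IE.from h) ≡ IV.from (sH h)
    inverse-comm sG sH comm h = begin
      sG (IE.from h)                  ≡⟨ IV.strictlyInverseʳ _ ⟨
      IV.from (fV (sG (IE.from h)))   ≡⟨ cong IV.from (comm (IE.from h)) ⟨
      IV.from (sH (fE (IE.from h)))   ≡⟨ cong (IV.from ∘ sH) (IE.strictlyInverseˡ h) ⟩
      IV.from (sH h)                  ∎
      where open ≡-Reasoning

  Iso-sym : Iso H G
  Iso-sym = record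
    { fV     = IV.from
    ; fE     = IE.from
    ; fV-bij = inverses⇒bijective IV.from fV IV.strictlyInverseʳ IV.strictlyInverseˡ
    ; fE-bij = inverses⇒bijective IE.from fE IE.strictlyInverseʳ IE.strictlyInverseˡ
    ; o-comm = inverse-comm (o G) (o H) o-comm
    ; t-comm = inverse-comm (t G) (t H) t-comm
    }

  Iso-sym-fV : ∀ v → Iso.fV Iso-sym (fV v) ≡ v
  Iso-sym-fV = IV.strictlyInverseʳ

  fE-Iso-sym : ∀ h → fE (Iso.fE Iso-sym h) ≡ h
  fE-Iso-sym = IE.strictlyInverseˡ

RootedIso-refl : ∀ {A} → RootedIso A A
RootedIso-refl = record
  { iso = record
    { fV = id ; fE = id
    ; fV-bij = Identity.bijective _≡_ ; fE-bij = Identity.bijective _≡_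
    ; o-comm = λ _ → refl ; t-comm = λ _ → refl
    }
  ; root-pres = refl
  }

RootedIso-sym : ∀ {A B} → RootedIso A B → RootedIso B A
RootedIso-sym {A} record { iso = i ; root-pres = refl } = record
  { iso = Iso-sym i ; root-pres = Iso-sym-fV i (root A) }

RootedIso-trans : ∀ {A B C} → RootedIso A B → RootedIso B C → RootedIso A C
RootedIso-trans record { iso = i ; root-pres = refl } record { iso = j ; root-pres = refl } = record
  { iso = record
    { fV     = J.fV ∘ I.fV
    ; fE     = J.fE ∘ I.fE
    ; fV-bij = Composition.bijective _≡_ _≡_ _≡_ I.fV-bij J.fV-bij
    ; fE-bij = Composition.bijective _≡_ _≡_ _≡_ I.fE-bij J.fE-bij
    ; o-comm = λ e → trans (J.o-comm (I.fE e)) (cong J.fV (I.o-comm e))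
    ; t-comm = λ e → trans (J.t-comm (I.fE e)) (cong J.fV (I.t-comm e))
    }
  ; root-pres = refl
  }
  where
    module I = Iso i
    module J = Iso j

record Hom (G H : Graph) : Set where
  field
    fV     : V G → V H
    fE     : E G → E H
    o-comm : ∀ e → o H (fE e) ≡ fV (o G e)
    t-comm : ∀ e → t H (fE e) ≡ fV (t G e)

record Covering (G H : Graph) : Set where
  field
    hom : Hom G H
  open Hom hom public
  field
    lift        : ∀ {v} h → o H h ≡ fV v → Σ[ e ∈ E G ] (o G e ≡ v × fE e ≡ h)
    lift-unique : ∀ {e e'} → o G e ≡ o G e' → fE e ≡ fE e' → e ≡ e'

kernel : {G H : Graph} → Hom G H → GraphEquiv G
kernel {H = H} f = record
  { _~V_     = λ x y → fV x ≡ fV y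
  ; _~E_     = λ e e' → fE e ≡ fE e'
  ; ~V-equiv = On.isEquivalence fV isEquivalence
  ; ~E-equiv = On.isEquivalence fE isEquivalence
  ; o-resp   = λ {e} {e'} eq → trans (sym (o-comm e)) (trans (cong (o H) eq) (o-comm e'))
  ; t-resp   = λ {e} {e'} eq → trans (sym (t-comm e)) (trans (cong (t H) eq) (t-comm e'))
  }
  where open Hom f

kernel-isQuotient : {G H : Graph} (f : Hom G H) →
                    Surjective _≡_ _≡_ (Hom.fV f) → Surjective _≡_ _≡_ (Hom.fE f) →
                    IsQuotient G (kernel f) H (Hom.fV f) (Hom.fE f)
kernel-isQuotient f fV-surj fE-surj = record
  { pV-surj = fV-surj
  ; pE-surj = fE-surj
  ; pV-ker  = λ _ _ → mk⇔ id id
  ; pE-ker  = λ _ _ → mk⇔ id id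
  ; o-ind   = o-comm
  ; t-ind   = t-comm
  }
  where open Hom f

covering⇒kernel-nonEdgeCollapsing : {G H : Graph} (c : Covering G H) →
                                    NonEdgeCollapsing (kernel (Covering.hom c))
covering⇒kernel-nonEdgeCollapsing c v v' fv≡fv' e refl =
  let (e' , oe'≡v' , fe'≡fe) = lift (fE e) (trans (o-comm e) fv≡fv')
  in  e' , (oe'≡v' , sym fe'≡fe) ,
      λ e'' oe''≡v' fe≡fe'' → lift-unique (trans oe''≡v' (sym oe'≡v')) (trans (sym fe≡fe'') (sym fe'≡fe))
  where open Covering c

iso⇒covering : {G H : Graph} → Iso G H → Covering G H
iso⇒covering {G} {H} i = record
  { hom         = record { fV = fV ; fE = fE ; o-comm = o-comm ; t-comm = t-comm }
  ; lift        = λ {v} h oh≡fv → fE⁻¹ h , (begin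
      o G (fE⁻¹ h)   ≡⟨ Iso.o-comm (Iso-sym i) h ⟩
      fV⁻¹ (o H h)   ≡⟨ cong fV⁻¹ oh≡fv ⟩
      fV⁻¹ (fV v)    ≡⟨ Iso-sym-fV i v ⟩
      v              ∎) , fE-Iso-sym i h
  ; lift-unique = λ _ → proj₁ fE-bij
  }
  where
    open Iso i
    open Iso (Iso-sym i) renaming (fV to fV⁻¹; fE to fE⁻¹) using ()
    open ≡-Reasoning

quotient⇒covering : {G H : Graph} {R : GraphEquiv G} {pV : V G → V H} {pE : E G → E H} →
                    NonEdgeCollapsing R → IsQuotient G R H pV pE → Covering G H
quotient⇒covering {G} {H} {R} {pV} {pE} nec q = record
  { hom         = record { fV = pV ; fE = pE ; o-comm = o-ind ; t-comm = t-ind }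
  ; lift        = lift
  ; lift-unique = lift-unique
  }
  where
    open GraphEquiv R
    open IsQuotient q
    open Equivalence using (to; from)

    module ~V = IsEquivalence ~V-equiv
    module ~E = IsEquivalence ~E-equiv

    lift : ∀ {v} h → o H h ≡ pV v → Σ[ e ∈ E G ] (o G e ≡ v × pE e ≡ h)
    lift {v} h oh≡pv =
      let (e₀ , pe₀≡h)            = pE-surj h
          oe₀~v                   = to (pV-ker _ _)
                                      (trans (sym (o-ind e₀)) (trans (cong (o H) (pe₀≡h refl)) oh≡pv))
          (e , (oe≡v , e₀~e) , _) = nec (o G e₀) v oe₀~v e₀ refl
      in  e , oe≡v , trans (from (pE-ker e e₀) (~E.sym e₀~e)) (pe₀≡h refl)

    lift-unique : ∀ {e e'} → o G e ≡ o G e' → pE e ≡ pE e' → e ≡ e'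
    lift-unique {e} {e'} oe≡oe' pe≡pe' =
      let (_ , _ , unique) = nec (o G e) (o G e) ~V.refl e refl
      in  trans (unique e refl ~E.refl) (sym (unique e' (sym oe≡oe') (to (pE-ker e e') pe≡pe')))

unfold-covering : (G : Graph) (S : V G) → Covering (UnfoldGraph G S) G
unfold-covering G S = record
  { hom         = record { fV = proj₁ ; fE = proj₁ ; o-comm = λ _ → refl ; t-comm = λ _ → refl }
  ; lift        = λ { {_ , w} h refl → (h , w) , refl , refl }
  ; lift-unique = λ { refl refl → refl }
  }

module _ {G : Graph} {S : V G} where
  private
    T = UnfoldGraph G S

  ∷ʳ-cong : ∀ {v₁ v₂} {w₁ : WalkFrom G S v₁} {w₂ : WalkFrom G S v₂} {e₁ e₂ : E G}
              {p₁ : o G e₁ ≡ v₁} {p₂ : o G e₂ ≡ v₂} →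
            _≡_ {A = V T} (v₁ , w₁) (v₂ , w₂) → e₁ ≡ e₂ →
            _≡_ {A = V T} (t G e₁ , (w₁ ∷ʳ e₁) {p₁}) (t G e₂ , (w₂ ∷ʳ e₂) {p₂})
  ∷ʳ-cong {p₁ = refl} {p₂ = refl} refl refl = refl

  unfold-edge-≡ : ∀ {e e' : E G} {w : WalkFrom G S (o G e)} {w' : WalkFrom G S (o G e')} →
                  e ≡ e' → _≡_ {A = V T} (o G e , w) (o G e' , w') → _≡_ {A = E T} (e , w) (e' , w')
  unfold-edge-≡ refl refl = refl

module Lifting {G H : Graph} (c : Covering G H) (S : V G) where
  open Covering c

  private
    TG = UnfoldGraph G S
    TH = UnfoldGraph H (fV S)

  data _↦_ : ∀ {v x} → WalkFrom G S v → WalkFrom H (fV S) x → Set where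
    ε    : ε ↦ ε
    step : ∀ {v x e h p q} {w : WalkFrom G S v} {w' : WalkFrom H (fV S) x} →
           w ↦ w' → fE e ≡ h → (w ∷ʳ e) {p} ↦ (w' ∷ʳ h) {q}

  ↦-end : ∀ {v x} {w : WalkFrom G S v} {w' : WalkFrom H (fV S) x} → w ↦ w' → fV v ≡ x
  ↦-end ε                     = refl
  ↦-end (step {e = e} _ fe≡h) = trans (sym (t-comm e)) (cong (t H) fe≡h)

  ↦-functional : ∀ {v x₁ x₂} {w : WalkFrom G S v}
                   {w₁ : WalkFrom H (fV S) x₁} {w₂ : WalkFrom H (fV S) x₂} →
                 w ↦ w₁ → w ↦ w₂ → _≡_ {A = V TH} (x₁ , w₁) (x₂ , w₂)
  ↦-functional ε                ε                = refl
  ↦-functional (step r₁ fe≡h₁) (step r₂ fe≡h₂) = ∷ʳ-cong (↦-functional r₁ r₂) (trans (sym fe≡h₁) fe≡h₂)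

  ↦-injective : ∀ {v₁ v₂ x} {w₁ : WalkFrom G S v₁} {w₂ : WalkFrom G S v₂}
                  {w' : WalkFrom H (fV S) x} →
                w₁ ↦ w' → w₂ ↦ w' → _≡_ {A = V TG} (v₁ , w₁) (v₂ , w₂)
  ↦-injective ε ε = refl
  ↦-injective (step {p = p₁} r₁ fe₁≡h) (step {p = p₂} r₂ fe₂≡h) =
    ∷ʳ-cong same-walk (lift-unique (trans p₁ (trans (cong proj₁ same-walk) (sym p₂))) (trans fe₁≡h (sym fe₂≡h)))
    where same-walk = ↦-injective r₁ r₂

  -- The endpoint x is an argument so that images of tree edges can be built at o H (fE e) without a cast.
  map-walk : ∀ {v x} (w : WalkFrom G S v) → fV v ≡ x → Σ[ w' ∈ WalkFrom H (fV S) x ] w ↦ w'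
  map-walk ε refl = ε , ε
  map-walk (_∷ʳ_ w e {p}) fv≡x with trans (t-comm e) fv≡x
  ... | refl = (proj₁ mapped ∷ʳ fE e) {refl} , step (proj₂ mapped) refl
    where mapped = map-walk w (trans (cong fV (sym p)) (sym (o-comm e)))

  lift-walk : ∀ {x} (w' : WalkFrom H (fV S) x) → Σ[ (v , w) ∈ V TG ] w ↦ w'
  lift-walk ε = (S , ε) , ε
  lift-walk (_∷ʳ_ w' h {p}) =
    let ((_ , w) , r)      = lift-walk w'
        (e , oe≡v , fe≡h) = lift h (trans p (sym (↦-end r)))
    in  (t G e , (w ∷ʳ e) {oe≡v}) , step r fe≡h

  lift-edge : (h : E H) (w' : WalkFrom H (fV S) (o H h)) → Σ[ (e , w) ∈ E TG ] (fE e ≡ h × w ↦ w')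
  lift-edge h w' with lift-walk w'
  ... | (_ , w) , r with lift h (sym (↦-end r))
  ... | e , refl , fe≡h = (e , w) , fe≡h , r

  private
    mapV : V TG → V TH
    mapV (v , w) = fV v , proj₁ (map-walk w refl)

    mapE : E TG → E TH
    mapE (e , w) = fE e , proj₁ (map-walk w (sym (o-comm e)))

    liftV : V TH → V TG
    liftV (_ , w') = proj₁ (lift-walk w')

    liftE : E TH → E TG
    liftE (h , w') = proj₁ (lift-edge h w')

    mapV∘liftV : ∀ x → mapV (liftV x) ≡ x
    mapV∘liftV (_ , w') = ↦-functional (proj₂ (map-walk _ refl)) (proj₂ (lift-walk w'))

    liftV∘mapV : ∀ x → liftV (mapV x) ≡ x
    liftV∘mapV (_ , w) = ↦-injective (proj₂ (lift-walk _)) (proj₂ (map-walk w refl))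

    mapE∘liftE : ∀ x → mapE (liftE x) ≡ x
    mapE∘liftE (h , w') =
      let ((_ , w) , fe≡h , r) = lift-edge h w'
      in  unfold-edge-≡ fe≡h (↦-functional (proj₂ (map-walk w _)) r)

    liftE∘mapE : ∀ x → liftE (mapE x) ≡ x
    liftE∘mapE (e , w) =
      let (w' , r)            = map-walk w (sym (o-comm e))
          (_ , fe''≡fe , r'') = lift-edge (fE e) w'
          same-walk           = ↦-injective r'' r
      in  unfold-edge-≡ (lift-unique (cong proj₁ same-walk) fe''≡fe) same-walk

  unfold-iso : Iso TG TH
  unfold-iso = record
    { fV     = mapV
    ; fE     = mapE
    ; fV-bij = inverses⇒bijective mapV liftV mapV∘liftV liftV∘mapV
    ; fE-bij = inverses⇒bijective mapE liftE mapE∘liftE liftE∘mapE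
    ; o-comm = λ { (e , w) → ↦-functional (proj₂ (map-walk w _)) (proj₂ (map-walk w refl)) }
    ; t-comm = λ { (e , w) → ↦-functional (step (proj₂ (map-walk w _)) refl) (proj₂ (map-walk _ refl)) }
    }

covering⇒𝒯-iso : ∀ {A B} (c : Covering (graph A) (graph B)) →
                 Covering.fV c (root A) ≡ root B → RootedIso (𝒯 A) (𝒯 B)
covering⇒𝒯-iso {A} c refl = record { iso = Lifting.unfold-iso c (root A) ; root-pres = refl }

≃⇒𝒯-iso : ∀ {A B} → A ≃ B → RootedIso (𝒯 A) (𝒯 B)
≃⇒𝒯-iso {A} {B} (≃-iso i) =
  covering⇒𝒯-iso {A} {B} (iso⇒covering (RootedIso.iso i)) (RootedIso.root-pres i)
≃⇒𝒯-iso (≃-quot A _ nec H pV _ q r) =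
  covering⇒𝒯-iso {A} {rooted H (pV (root A)) r} (quotient⇒covering nec q) refl
≃⇒𝒯-iso ≃-refl                      = RootedIso-refl
≃⇒𝒯-iso (≃-sym A≃B)                 = RootedIso-sym (≃⇒𝒯-iso A≃B)
≃⇒𝒯-iso (≃-trans A≃B B≃C)           = RootedIso-trans (≃⇒𝒯-iso A≃B) (≃⇒𝒯-iso B≃C)

𝒯≃ : ∀ A → 𝒯 A ≃ A
𝒯≃ A = ≃-quot (𝒯 A) (kernel (Covering.hom projection))
         (covering⇒kernel-nonEdgeCollapsing projection)
         (graph A) proj₁ proj₁
         (kernel-isQuotient (Covering.hom projection)
           (λ v → (v , isRoot A v) , λ { refl → refl })
           (λ e → (e , isRoot A (o (graph A) e)) , λ { refl → refl }))
         (isRoot A)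
  where projection = unfold-covering (graph A) (root A)

theorem5 : ∀ (A B : Rooted) → RootedIso (𝒯 A) (𝒯 B) ⇔ (A ≃ B)
theorem5 A B = mk⇔
  (λ 𝒯A≅𝒯B → ≃-trans (≃-sym (𝒯≃ A)) (≃-trans (≃-iso 𝒯A≅𝒯B) (𝒯≃ B)))
  ≃⇒𝒯-iso
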